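{- Let $a,k,t,\rho$ be real numbers with $a\ge k+1>1$, $t\ge1$ and $\rho>0$. Let $\xi=(a+tk,t,1)$, $Q_1=(a,0,1)$, $Q_2=(a+\rho,0,1)$, and let $\alpha$ be the angle between the planes spanned by $(\xi,Q_1)$ and by $(\xi,Q_2)$. Let $L:\mathbb R^3\to\mathbb R^3$, $L(x,y,z)=(x-z,y,z)$ (the change of coordinates induced by the basis transformation $V_{1,0;0}(e_1,e_2,e_3)=(e_1,e_2,e_3+e_1)$), and let $\alpha'$ be the angle between the planes spanned by $(L\xi,LQ_1)$ and by $(L\xi,LQ_2)$. Then $\sin^2\alpha'>\sin^2\alpha$; that is, $V_{1,0;0}$ increases $\sin^2\alpha$ for such a state.
   Context: Angles between planes are taken in $[0,\pi/2]$ with respect to the standard Euclidean inner product on coordinate vectors. -}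

module Defs where

open import Level using (0ℓ)
open import Data.Product using (Σ; ∃; _×_; _,_)
open import Data.Sum using (_⊎_)
open import Relation.Binary.PropositionalEquality using (_≡_)
open import Relation.Binary.Structures using (IsStrictTotalOrder)
open import Relation.Nullary using (¬_)
open import Algebra.Structures using (IsCommutativeRing)

-- The real numbers, axiomatised as a Dedekind-complete ordered field
-- (this characterises ℝ up to isomorphism).  Equality is propositional.
record RealField : Set₁ where
  infixl 7 _*_
  infixl 6 _+_ _-_
  infix  4 _<_ _≤_
  field
    Carrier : Set
    _+_ _*_ : Carrier → Carrier → Carrier
    -_      : Carrier → Carrier
    0# 1#   : Carrier
    _⁻¹     : Carrier → Carrier
    _<_     : Carrier → Carrier → Set
    isCommutativeRing : IsCommutativeRing _≡_ _+_ _*_ -_ 0# 1#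
    0≢1      : ¬ (0# ≡ 1#)
    ⁻¹-inverse : ∀ x → ¬ (x ≡ 0#) → x * (x ⁻¹) ≡ 1#
    isStrictTotalOrder : IsStrictTotalOrder _≡_ _<_
    +-mono-< : ∀ {x y} z → x < y → x + z < y + z
    *-pos    : ∀ {x y} → 0# < x → 0# < y → 0# < x * y

  _≤_ : Carrier → Carrier → Set
  x ≤ y = x < y ⊎ x ≡ y

  _-_ : Carrier → Carrier → Carrier
  x - y = x + (- y)

  field
    complete : (P : Carrier → Set) → Σ Carrier P →
               Σ Carrier (λ b → ∀ x → P x → x ≤ b) →
               Σ Carrier (λ s → (∀ x → P x → x ≤ s) ×
                                (∀ b → (∀ x → P x → x ≤ b) → s ≤ b))

module Geometry (R : RealField) where
  open RealField R public

  record V3 : Set where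
    constructor ⟨_,_,_⟩
    field
      x y z : Carrier

  _·_ : V3 → V3 → Carrier
  ⟨ x₁ , y₁ , z₁ ⟩ · ⟨ x₂ , y₂ , z₂ ⟩ = x₁ * x₂ + y₁ * y₂ + z₁ * z₂

  _×ᵥ_ : V3 → V3 → V3
  ⟨ x₁ , y₁ , z₁ ⟩ ×ᵥ ⟨ x₂ , y₂ , z₂ ⟩ =
    ⟨ y₁ * z₂ - z₁ * y₂ , z₁ * x₂ - x₁ * z₂ , x₁ * y₂ - y₁ * x₂ ⟩

  -- sin² of the angle α ∈ [0, π/2] between the planes span(u,v) and span(w,s):
  -- with normals n₁ = u × v, n₂ = w × s, cos α = |n₁·n₂| / (|n₁| |n₂|), so
  -- sin² α = 1 - (n₁·n₂)² / (|n₁|² |n₂|²).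
  sin²PlaneAngle : V3 → V3 → V3 → V3 → Carrier
  sin²PlaneAngle u v w s =
    1# - (d * d) * (((n₁ · n₁) * (n₂ · n₂)) ⁻¹)
    where
      n₁ = u ×ᵥ v
      n₂ = w ×ᵥ s
      d  = n₁ · n₂

  L : V3 → V3
  L ⟨ x , y , z ⟩ = ⟨ x - z , y , z ⟩

  ξ : (a k t : Carrier) → V3
  ξ a k t = ⟨ a + t * k , t , 1# ⟩

  Q₁ : (a : Carrier) → V3
  Q₁ a = ⟨ a , 0# , 1# ⟩

  Q₂ : (a ρ : Carrier) → V3
  Q₂ a ρ = ⟨ a + ρ , 0# , 1# ⟩

-- Both planes contain ξ, so by Lagrange's identity
-- sin² α = |n₁ × n₂|² / (|n₁|² |n₂|²) with nᵢ = ξ × Qᵢ, and n₁ × n₂ = det(ξ, Q₁, Q₂) ξ.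
-- The determinant equals tρ before and after the shear L, whose only effect on ξ, Q₁, Q₂
-- is to shift their first coordinates by −1.  Comparing the two closed forms reduces the
-- claim to two polynomial inequalities, which become evident after the substitution
-- a = 1 + k + s, t = 1 + u: the relevant polynomials in k, s, u, ρ ≥ 0 have nonnegative
-- coefficients and constant term 1.

module Submission where

open import Algebra.Bundles using (CommutativeRing)
open import Algebra.Solver.Ring.AlmostCommutativeRing
  using (fromCommutativeRing; _-Raw-AlmostCommutative⟶_)
open import Data.Empty using (⊥-elim)
open import Data.Fin using (Fin; #_)
open import Data.Integer as ℤ using (ℤ; +_; -[1+_]; _⊖_; _◃_; 0ℤ; 1ℤ)
import Data.Integer.Properties as ℤ
open import Data.Maybe using (Maybe; just; nothing)
open import Data.Nat as ℕ using (ℕ; zero; suc)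
import Data.Nat.Properties as ℕ
open import Data.Product as Product using (_,_)
open import Data.Sign as Sign using (Sign)
open import Data.Sum using (inj₁; inj₂)
open import Data.Vec using (Vec; []; _∷_; lookup)
open import Data.Vec.Relation.Unary.All using (All; []; _∷_)
open import Data.Vec.Relation.Unary.All.Properties using (lookup⁺)
open import Level using (0ℓ)
open import Relation.Binary.Definitions using (tri<; tri≈; tri>)
open import Relation.Binary.PropositionalEquality as ≡ using (_≡_)
open import Relation.Binary.Structures using (IsStrictTotalOrder)
open import Relation.Nullary using (¬_; yes; no)

open import Defs

-- With integer coefficients the normaliser can cancel (x − x = 0), which a solver whose
-- coefficients are elements of an abstract carrier cannot.
module IntegerCoefficientRingSolver {c ℓ} (R : CommutativeRing c ℓ) where

  open CommutativeRing R
  open import Algebra.Properties.Ring ring using (-1*x≈-x)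
  open import Algebra.Properties.AbelianGroup +-abelianGroup
    using (⁻¹-∙-comm; ⁻¹-involutive; ε⁻¹≈ε; xyx⁻¹≈y)
  open import Algebra.Properties.CommutativeSemigroup *-commutativeSemigroup
    using (interchange)
  open import Algebra.Properties.Semiring.Mult.TCOptimised semiring
    using (_×_; 1+×; ×-homo-+; ×1-homo-*)
  open import Relation.Binary.Reasoning.Setoid setoid

  -- The optimised multiple makes fromℤ 1ℤ reduce to 1#, so solver constants match goals literally.
  fromℤ : ℤ → Carrier
  fromℤ (+ n)    = n × 1#
  fromℤ -[1+ n ] = - (suc n × 1#)

  +-cancelˡ-- : ∀ x y z → (x + y) - (x + z) ≈ y - z
  +-cancelˡ-- x y z = begin
    (x + y) + - (x + z)    ≈⟨ +-congˡ (⁻¹-∙-comm x z) ⟨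
    (x + y) + (- x + - z)  ≈⟨ +-assoc (x + y) (- x) (- z) ⟨
    (x + y) + - x + - z    ≈⟨ +-congʳ (xyx⁻¹≈y x y) ⟩
    y + - z                ∎

  fromℤ-⊖ : ∀ m n → fromℤ (m ⊖ n) ≈ m × 1# - n × 1#
  fromℤ-⊖ zero    zero    = sym (-‿inverseʳ 0#)
  fromℤ-⊖ zero    (suc n) = sym (+-identityˡ _)
  fromℤ-⊖ (suc m) zero    = sym (trans (+-congˡ ε⁻¹≈ε) (+-identityʳ _))
  fromℤ-⊖ (suc m) (suc n) = begin
    fromℤ (suc m ⊖ suc n)          ≡⟨ ≡.cong fromℤ (ℤ.[1+m]⊖[1+n]≡m⊖n m n) ⟩
    fromℤ (m ⊖ n)                  ≈⟨ fromℤ-⊖ m n ⟩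
    m × 1# - n × 1#                ≈⟨ +-cancelˡ-- 1# (m × 1#) (n × 1#) ⟨
    (1# + m × 1#) - (1# + n × 1#)  ≈⟨ +-cong (1+× m 1#) (-‿cong (1+× n 1#)) ⟨
    suc m × 1# - suc n × 1#        ∎

  fromℤ-+ : ∀ i j → fromℤ (i ℤ.+ j) ≈ fromℤ i + fromℤ j
  fromℤ-+ (+ m)    (+ n)    = ×-homo-+ 1# m n
  fromℤ-+ (+ m)    -[1+ n ] = fromℤ-⊖ m (suc n)
  fromℤ-+ -[1+ m ] (+ n)    = trans (fromℤ-⊖ n (suc m)) (+-comm _ _)
  fromℤ-+ -[1+ m ] -[1+ n ] = begin
    - (suc (suc (m ℕ.+ n)) × 1#)     ≡⟨ ≡.cong (λ l → - (suc l × 1#)) (ℕ.+-suc m n) ⟨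
    - ((suc m ℕ.+ suc n) × 1#)       ≈⟨ -‿cong (×-homo-+ 1# (suc m) (suc n)) ⟩
    - (suc m × 1# + suc n × 1#)      ≈⟨ ⁻¹-∙-comm _ _ ⟨
    - (suc m × 1#) + - (suc n × 1#)  ∎

  fromℤ-neg : ∀ i → fromℤ (ℤ.- i) ≈ - fromℤ i
  fromℤ-neg -[1+ n ]    = sym (⁻¹-involutive _)
  fromℤ-neg (+ zero)    = sym ε⁻¹≈ε
  fromℤ-neg (+ (suc n)) = refl

  fromSign : Sign → Carrier
  fromSign Sign.+ = 1#
  fromSign Sign.- = - 1#

  fromℤ-◃ : ∀ s n → fromℤ (s ◃ n) ≈ fromSign s * n × 1#
  fromℤ-◃ s       zero    = sym (zeroʳ _)
  fromℤ-◃ Sign.+ (suc n) = sym (*-identityˡ _)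
  fromℤ-◃ Sign.- (suc n) = sym (-1*x≈-x _)

  fromSign-* : ∀ s r → fromSign (s Sign.* r) ≈ fromSign s * fromSign r
  fromSign-* Sign.+ Sign.+ = sym (*-identityˡ _)
  fromSign-* Sign.+ Sign.- = sym (*-identityˡ _)
  fromSign-* Sign.- Sign.+ = sym (*-identityʳ _)
  fromSign-* Sign.- Sign.- = sym (trans (-1*x≈-x (- 1#)) (⁻¹-involutive 1#))

  fromℤ-sign-abs : ∀ i → fromℤ i ≈ fromSign (ℤ.sign i) * ℤ.∣ i ∣ × 1#
  fromℤ-sign-abs i = trans (reflexive (≡.cong fromℤ (≡.sym (ℤ.◃-inverse i))))
                           (fromℤ-◃ (ℤ.sign i) ℤ.∣ i ∣)

  fromℤ-* : ∀ i j → fromℤ (i ℤ.* j) ≈ fromℤ i * fromℤ j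
  fromℤ-* i j = begin
    fromℤ (ℤ.sign i Sign.* ℤ.sign j ◃ ℤ.∣ i ∣ ℕ.* ℤ.∣ j ∣)
      ≈⟨ fromℤ-◃ (ℤ.sign i Sign.* ℤ.sign j) (ℤ.∣ i ∣ ℕ.* ℤ.∣ j ∣) ⟩
    fromSign (ℤ.sign i Sign.* ℤ.sign j) * (ℤ.∣ i ∣ ℕ.* ℤ.∣ j ∣) × 1#
      ≈⟨ *-cong (fromSign-* (ℤ.sign i) (ℤ.sign j)) (×1-homo-* ℤ.∣ i ∣ ℤ.∣ j ∣) ⟩
    (fromSign (ℤ.sign i) * fromSign (ℤ.sign j)) * (ℤ.∣ i ∣ × 1# * ℤ.∣ j ∣ × 1#)
      ≈⟨ interchange _ _ _ _ ⟩
    (fromSign (ℤ.sign i) * ℤ.∣ i ∣ × 1#) * (fromSign (ℤ.sign j) * ℤ.∣ j ∣ × 1#)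
      ≈⟨ *-cong (fromℤ-sign-abs i) (fromℤ-sign-abs j) ⟨
    fromℤ i * fromℤ j
      ∎

  fromℤ-homomorphism : ℤ.+-*-rawRing -Raw-AlmostCommutative⟶ fromCommutativeRing R
  fromℤ-homomorphism = record
    { ⟦_⟧ = fromℤ ; +-homo = fromℤ-+ ; *-homo = fromℤ-* ; -‿homo = fromℤ-neg
    ; 0-homo = refl ; 1-homo = refl
    }

  fromℤ-≟ : ∀ i j → Maybe (fromℤ i ≈ fromℤ j)
  fromℤ-≟ i j with i ℤ.≟ j
  ... | yes ≡.refl = just refl
  ... | no  _      = nothing

  open import Algebra.Solver.Ring ℤ.+-*-rawRing (fromCommutativeRing R)
    fromℤ-homomorphism fromℤ-≟ public

module OrderedFieldProperties (R : RealField) where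

  open RealField R

  commutativeRing : CommutativeRing 0ℓ 0ℓ
  commutativeRing = record { isCommutativeRing = isCommutativeRing }

  open CommutativeRing commutativeRing
    using (semiring; +-comm; +-identityˡ; +-identityʳ; -‿inverseʳ; zeroˡ; zeroʳ)
  open IsStrictTotalOrder isStrictTotalOrder using (compare; irrefl) renaming (trans to <-trans)
  open IntegerCoefficientRingSolver commutativeRing using (solve; _:=_; _:+_; _:*_; _:-_; :-_; con)
  open import Algebra.Properties.Semiring.Mult.TCOptimised semiring using (_×_)

  <-irrefl : ∀ {x} → ¬ (x < x)
  <-irrefl = irrefl ≡.refl

  x<y⇒0<y-x : ∀ {x y} → x < y → 0# < y - x
  x<y⇒0<y-x {x} {y} x<y = ≡.subst (_< y - x) (-‿inverseʳ x) (+-mono-< (- x) x<y)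

  0<y-x⇒x<y : ∀ {x y} → 0# < y - x → x < y
  0<y-x⇒x<y {x} {y} 0<y-x =
    ≡.subst₂ _<_ (+-identityˡ x) (solve 2 (λ x y → y :- x :+ x := y) ≡.refl x y) (+-mono-< x 0<y-x)

  x≤y⇒0≤y-x : ∀ {x y} → x ≤ y → 0# ≤ y - x
  x≤y⇒0≤y-x (inj₁ x<y)    = inj₁ (x<y⇒0<y-x x<y)
  x≤y⇒0≤y-x (inj₂ ≡.refl) = inj₂ (≡.sym (-‿inverseʳ _))

  x<0⇒0<-x : ∀ {x} → x < 0# → 0# < - x
  x<0⇒0<-x x<0 = ≡.subst (0# <_) (+-identityˡ _) (x<y⇒0<y-x x<0)

  0<1 : 0# < 1#
  0<1 with compare 0# 1#
  ... | tri< 0<1 _ _ = 0<1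
  ... | tri≈ _ 0≡1 _ = ⊥-elim (0≢1 0≡1)
  ... | tri> _ _ 1<0 = ⊥-elim (<-irrefl (<-trans 1<0 (≡.subst (0# <_) -1*-1≡1 (*-pos 0<-1 0<-1))))
    where
      0<-1 = x<0⇒0<-x 1<0
      -1*-1≡1 = solve 0 (:- con 1ℤ :* :- con 1ℤ := con 1ℤ) ≡.refl

  pos+nonneg⇒pos : ∀ {x y} → 0# < x → 0# ≤ y → 0# < x + y
  pos+nonneg⇒pos {x} {y} 0<x (inj₁ 0<y) =
    <-trans 0<y (≡.subst (_< x + y) (+-identityˡ y) (+-mono-< y 0<x))
  pos+nonneg⇒pos {x} 0<x (inj₂ ≡.refl) = ≡.subst (0# <_) (≡.sym (+-identityʳ x)) 0<x

  nonneg+pos⇒pos : ∀ {x y} → 0# ≤ x → 0# < y → 0# < x + y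
  nonneg+pos⇒pos {x} {y} 0≤x 0<y = ≡.subst (0# <_) (+-comm y x) (pos+nonneg⇒pos 0<y 0≤x)

  nonneg+nonneg⇒nonneg : ∀ {x y} → 0# ≤ x → 0# ≤ y → 0# ≤ x + y
  nonneg+nonneg⇒nonneg (inj₁ 0<x)    0≤y = inj₁ (pos+nonneg⇒pos 0<x 0≤y)
  nonneg+nonneg⇒nonneg (inj₂ ≡.refl) 0≤y = ≡.subst (0# ≤_) (≡.sym (+-identityˡ _)) 0≤y

  nonneg*nonneg⇒nonneg : ∀ {x y} → 0# ≤ x → 0# ≤ y → 0# ≤ x * y
  nonneg*nonneg⇒nonneg (inj₁ 0<x)    (inj₁ 0<y)    = inj₁ (*-pos 0<x 0<y)
  nonneg*nonneg⇒nonneg (inj₁ _)      (inj₂ ≡.refl) = inj₂ (≡.sym (zeroʳ _))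
  nonneg*nonneg⇒nonneg (inj₂ ≡.refl) _             = inj₂ (≡.sym (zeroˡ _))

  0≤x*x : ∀ x → 0# ≤ x * x
  0≤x*x x with compare 0# x
  ... | tri< 0<x _ _    = inj₁ (*-pos 0<x 0<x)
  ... | tri≈ _ ≡.refl _ = inj₂ (≡.sym (zeroˡ 0#))
  ... | tri> _ _ x<0    = inj₁ (≡.subst (0# <_) -x*-x≡x*x (*-pos 0<-x 0<-x))
    where
      0<-x = x<0⇒0<-x x<0
      -x*-x≡x*x = solve 1 (λ x → :- x :* :- x := x :* x) ≡.refl x

  1≤x⇒0<x : ∀ {x} → 1# ≤ x → 0# < x
  1≤x⇒0<x (inj₁ 1<x)    = <-trans 0<1 1<x
  1≤x⇒0<x (inj₂ ≡.refl) = 0<1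

  0<x⇒x≢0 : ∀ {x} → 0# < x → ¬ (x ≡ 0#)
  0<x⇒x≢0 0<x ≡.refl = <-irrefl 0<x

  0<x⇒0<x⁻¹ : ∀ {x} → 0# < x → 0# < x ⁻¹
  0<x⇒0<x⁻¹ {x} 0<x with compare 0# (x ⁻¹)
  ... | tri< 0<x⁻¹ _ _ = 0<x⁻¹
  ... | tri≈ _ 0≡x⁻¹ _ =
    ⊥-elim (0≢1 (≡.trans (≡.sym (zeroʳ x)) (≡.trans (≡.cong (x *_) 0≡x⁻¹) x*x⁻¹≡1)))
    where x*x⁻¹≡1 = ⁻¹-inverse x (0<x⇒x≢0 0<x)
  ... | tri> _ _ x⁻¹<0 =
    ⊥-elim (<-irrefl (<-trans 0<1 (0<y-x⇒x<y (≡.subst (0# <_) x*-x⁻¹≡0-1 (*-pos 0<x (x<0⇒0<-x x⁻¹<0))))))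
    where
      x*-x⁻¹≡0-1 : x * - (x ⁻¹) ≡ 0# - 1#
      x*-x⁻¹≡0-1 = ≡.trans (solve 2 (λ x y → x :* :- y := con 0ℤ :- x :* y) ≡.refl x (x ⁻¹))
                           (≡.cong (λ z → 0# - z) (⁻¹-inverse x (0<x⇒x≢0 0<x)))

  *⁻¹-<-*⁻¹ : ∀ {x y X Y} → 0# < X → 0# < Y → x * Y < y * X → x * X ⁻¹ < y * Y ⁻¹
  *⁻¹-<-*⁻¹ {x} {y} {X} {Y} 0<X 0<Y xY<yX =
    0<y-x⇒x<y (≡.subst (0# <_) scaled
      (*-pos (x<y⇒0<y-x xY<yX) (*-pos (0<x⇒0<x⁻¹ 0<X) (0<x⇒0<x⁻¹ 0<Y))))
    where
      open ≡.≡-Reasoning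
      scaled : (y * X - x * Y) * (X ⁻¹ * Y ⁻¹) ≡ y * Y ⁻¹ - x * X ⁻¹
      scaled = begin
        (y * X - x * Y) * (X ⁻¹ * Y ⁻¹)
          ≡⟨ solve 6 (λ x y X Y X′ Y′ →
                (y :* X :- x :* Y) :* (X′ :* Y′) := y :* Y′ :* (X :* X′) :- x :* X′ :* (Y :* Y′))
              ≡.refl x y X Y (X ⁻¹) (Y ⁻¹) ⟩
        y * Y ⁻¹ * (X * X ⁻¹) - x * X ⁻¹ * (Y * Y ⁻¹)
          ≡⟨ ≡.cong₂ (λ p q → y * Y ⁻¹ * p - x * X ⁻¹ * q)
                     (⁻¹-inverse X (0<x⇒x≢0 0<X)) (⁻¹-inverse Y (0<x⇒x≢0 0<Y)) ⟩
        y * Y ⁻¹ * 1# - x * X ⁻¹ * 1#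
          ≡⟨ solve 2 (λ u v → u :* con 1ℤ :- v :* con 1ℤ := u :- v) ≡.refl (y * Y ⁻¹) (x * X ⁻¹) ⟩
        y * Y ⁻¹ - x * X ⁻¹
          ∎

  0≤n×1 : ∀ n → 0# ≤ n × 1#
  0≤n×1 0               = inj₂ ≡.refl
  0≤n×1 1               = inj₁ 0<1
  0≤n×1 (suc n@(suc _)) = nonneg+nonneg⇒nonneg (0≤n×1 n) (inj₁ 0<1)

infixl 6 _⊕_
infixl 7 _⊗_

data NatPoly (n : ℕ) : Set where
  var     : Fin n → NatPoly n
  lit     : ℕ → NatPoly n
  _⊕_ _⊗_ : NatPoly n → NatPoly n → NatPoly n

module NatPolyEvaluation (R : RealField) where

  open RealField R
  open OrderedFieldProperties R
  open IntegerCoefficientRingSolver commutativeRing using (Polynomial; con; _:+_; _:*_)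
  open import Algebra.Properties.Semiring.Mult.TCOptimised (CommutativeRing.semiring commutativeRing)
    using (_×_)

  eval : ∀ {n} → NatPoly n → Vec Carrier n → Carrier
  eval (var i) ρ = lookup ρ i
  eval (lit m) ρ = m × 1#
  eval (p ⊕ q) ρ = eval p ρ + eval q ρ
  eval (p ⊗ q) ρ = eval p ρ * eval q ρ

  eval-nonneg : ∀ {n} {ρ : Vec Carrier n} → All (0# ≤_) ρ → ∀ p → 0# ≤ eval p ρ
  eval-nonneg 0≤ρ (var i) = lookup⁺ 0≤ρ i
  eval-nonneg 0≤ρ (lit m) = 0≤n×1 m
  eval-nonneg 0≤ρ (p ⊕ q) = nonneg+nonneg⇒nonneg (eval-nonneg 0≤ρ p) (eval-nonneg 0≤ρ q)
  eval-nonneg 0≤ρ (p ⊗ q) = nonneg*nonneg⇒nonneg (eval-nonneg 0≤ρ p) (eval-nonneg 0≤ρ q)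

  -- Substitution into solver polynomials; its semantics unfolds definitionally to eval.
  toPolynomial : ∀ {m n} → NatPoly n → Vec (Polynomial m) n → Polynomial m
  toPolynomial (var i) σ = lookup σ i
  toPolynomial (lit m) σ = con (+ m)
  toPolynomial (p ⊕ q) σ = toPolynomial p σ :+ toPolynomial q σ
  toPolynomial (p ⊗ q) σ = toPolynomial p σ :* toPolynomial q σ

module PlaneAngles (R : RealField) where

  open Geometry R
  open OrderedFieldProperties R
  open IntegerCoefficientRingSolver commutativeRing
    using (Polynomial; solve; _:=_; _:+_; _:*_; _:-_; con)
  open ≡.≡-Reasoning

  private
    Triple : ℕ → Set
    Triple n = Polynomial n Product.× Polynomial n Product.× Polynomial n

    infix 9 _·ₚ_
    _·ₚ_ : ∀ {n} → Triple n → Triple n → Polynomial n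
    (x₁ , y₁ , z₁) ·ₚ (x₂ , y₂ , z₂) = x₁ :* x₂ :+ y₁ :* y₂ :+ z₁ :* z₂

    infixl 10 _×ₚ_
    _×ₚ_ : ∀ {n} → Triple n → Triple n → Triple n
    (x₁ , y₁ , z₁) ×ₚ (x₂ , y₂ , z₂) =
      (y₁ :* z₂ :- z₁ :* y₂ , z₁ :* x₂ :- x₁ :* z₂ , x₁ :* y₂ :- y₁ :* x₂)

  lagrange-identity : ∀ u v → (u · u) * (v · v) ≡ (u · v) * (u · v) + (u ×ᵥ v) · (u ×ᵥ v)
  lagrange-identity ⟨ u₁ , u₂ , u₃ ⟩ ⟨ v₁ , v₂ , v₃ ⟩ =
    solve 6 (λ u₁ u₂ u₃ v₁ v₂ v₃ → let u = (u₁ , u₂ , u₃) ; v = (v₁ , v₂ , v₃) in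
               (u ·ₚ u) :* (v ·ₚ v) := (u ·ₚ v) :* (u ·ₚ v) :+ (u ×ₚ v) ·ₚ (u ×ₚ v))
            ≡.refl u₁ u₂ u₃ v₁ v₂ v₃

  sin²PlaneAngle≡ : ∀ u v w s → let n₁ = u ×ᵥ v ; n₂ = w ×ᵥ s in
    ¬ ((n₁ · n₁) * (n₂ · n₂) ≡ 0#) →
    sin²PlaneAngle u v w s ≡ ((n₁ ×ᵥ n₂) · (n₁ ×ᵥ n₂)) * ((n₁ · n₁) * (n₂ · n₂)) ⁻¹
  sin²PlaneAngle≡ u v w s X≢0 = begin
    1# - A * X ⁻¹              ≡⟨ ≡.cong (λ z → z - A * X ⁻¹) (⁻¹-inverse X X≢0) ⟨
    X * X ⁻¹ - A * X ⁻¹        ≡⟨ ≡.cong (λ z → z * X ⁻¹ - A * X ⁻¹) (lagrange-identity n₁ n₂) ⟩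
    (A + C) * X ⁻¹ - A * X ⁻¹  ≡⟨ solve 3 (λ A C X′ → (A :+ C) :* X′ :- A :* X′ := C :* X′) ≡.refl A C (X ⁻¹) ⟩
    C * X ⁻¹                   ∎
    where
      n₁ = u ×ᵥ v
      n₂ = w ×ᵥ s
      A = (n₁ · n₂) * (n₁ · n₂)
      C = (n₁ ×ᵥ n₂) · (n₁ ×ᵥ n₂)
      X = (n₁ · n₁) * (n₂ · n₂)

  pencilNormal² : Carrier → Carrier → Carrier → Carrier
  pencilNormal² x t b = t * t * (1# + b * b) + (x - b) * (x - b)

  sin²Pencil : Carrier → Carrier → Carrier → Carrier → Carrier
  sin²Pencil x t b c =
    (t * (c - b)) * (t * (c - b)) * (x * x + t * t + 1#)
      * (pencilNormal² x t b * pencilNormal² x t c) ⁻¹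

  pencilNormal²-pos : ∀ {t} x b → 0# < t → 0# < pencilNormal² x t b
  pencilNormal²-pos x b 0<t =
    pos+nonneg⇒pos (*-pos (*-pos 0<t 0<t) (pos+nonneg⇒pos 0<1 (0≤x*x b))) (0≤x*x (x - b))

  private
    pₚ : ∀ {n} → Polynomial n → Polynomial n → Triple n
    pₚ x t = (x , t , con 1ℤ)

    qₚ : ∀ {n} → Polynomial n → Triple n
    qₚ b = (b , con 0ℤ , con 1ℤ)

  ∣p×q∣²≡pencilNormal² : ∀ x t b → let n = ⟨ x , t , 1# ⟩ ×ᵥ ⟨ b , 0# , 1# ⟩ in
    n · n ≡ pencilNormal² x t b
  ∣p×q∣²≡pencilNormal² = solve 3 (λ x t b →
    (pₚ x t ×ₚ qₚ b) ·ₚ (pₚ x t ×ₚ qₚ b) := t :* t :* (con 1ℤ :+ b :* b) :+ (x :- b) :* (x :- b))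
    ≡.refl

  -- (p × q₁) × (p × q₂) = det(p, q₁, q₂) p, and det(p, q₁, q₂) = t (c − b).
  ∣n₁×n₂∣²≡det²∣p∣² : ∀ x t b c →
    let n₁ = ⟨ x , t , 1# ⟩ ×ᵥ ⟨ b , 0# , 1# ⟩
        n₂ = ⟨ x , t , 1# ⟩ ×ᵥ ⟨ c , 0# , 1# ⟩
    in (n₁ ×ᵥ n₂) · (n₁ ×ᵥ n₂) ≡ (t * (c - b)) * (t * (c - b)) * (x * x + t * t + 1#)
  ∣n₁×n₂∣²≡det²∣p∣² = solve 4 (λ x t b c → let n₁ = pₚ x t ×ₚ qₚ b ; n₂ = pₚ x t ×ₚ qₚ c in
    (n₁ ×ₚ n₂) ·ₚ (n₁ ×ₚ n₂) := (t :* (c :- b)) :* (t :* (c :- b)) :* (x :* x :+ t :* t :+ con 1ℤ))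
    ≡.refl

  sin²PlaneAngle-pencil : ∀ x {t} b c → 0# < t →
    sin²PlaneAngle ⟨ x , t , 1# ⟩ ⟨ b , 0# , 1# ⟩ ⟨ x , t , 1# ⟩ ⟨ c , 0# , 1# ⟩ ≡ sin²Pencil x t b c
  sin²PlaneAngle-pencil x {t} b c 0<t = begin
    sin²PlaneAngle p q₁ p q₂                        ≡⟨ sin²PlaneAngle≡ p q₁ p q₂ (0<x⇒x≢0 0<∣n₁∣²∣n₂∣²) ⟩
    ((n₁ ×ᵥ n₂) · (n₁ ×ᵥ n₂)) * ∣n₁∣²∣n₂∣² ⁻¹        ≡⟨ ≡.cong₂ (λ C X → C * X ⁻¹) (∣n₁×n₂∣²≡det²∣p∣² x t b c) ∣n₁∣²∣n₂∣²≡ ⟩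
    sin²Pencil x t b c                               ∎
    where
      p = ⟨ x , t , 1# ⟩
      q₁ = ⟨ b , 0# , 1# ⟩
      q₂ = ⟨ c , 0# , 1# ⟩
      n₁ = p ×ᵥ q₁
      n₂ = p ×ᵥ q₂
      ∣n₁∣²∣n₂∣² = (n₁ · n₁) * (n₂ · n₂)
      ∣n₁∣²∣n₂∣²≡ : ∣n₁∣²∣n₂∣² ≡ pencilNormal² x t b * pencilNormal² x t c
      ∣n₁∣²∣n₂∣²≡ = ≡.cong₂ _*_ (∣p×q∣²≡pencilNormal² x t b) (∣p×q∣²≡pencilNormal² x t c)
      0<∣n₁∣²∣n₂∣² : 0# < ∣n₁∣²∣n₂∣²
      0<∣n₁∣²∣n₂∣² = ≡.subst (0# <_) (≡.sym ∣n₁∣²∣n₂∣²≡)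
                       (*-pos (pencilNormal²-pos x b 0<t) (pencilNormal²-pos x c 0<t))

module ShiftInequality (R : RealField) where

  open RealField R
  open OrderedFieldProperties R
  open NatPolyEvaluation R
  open PlaneAngles R using (pencilNormal²; pencilNormal²-pos; sin²Pencil)
  open IntegerCoefficientRingSolver commutativeRing
    using (Polynomial; solve; _:=_; _:+_; _:*_; _:-_; con)
  open ≡.≡-Reasoning

  -- Both polynomials are in k, s = a − (1 + k), u = t − 1 and ρ, all nonnegative under the
  -- hypotheses of the theorem.
  ratioGain : NatPoly 4
  ratioGain =
      lit 2 ⊗ u ⊕ u ⊗ u ⊕ lit 2 ⊗ s ⊕ lit 4 ⊗ s ⊗ u ⊕ lit 2 ⊗ s ⊗ u ⊗ u
    ⊕ k ⊗ (lit 2 ⊗ u ⊕ lit 2 ⊗ u ⊗ u ⊕ lit 2 ⊗ s ⊕ lit 2 ⊗ s ⊗ u ⊕ lit 2 ⊗ s ⊗ s ⊕ lit 2 ⊗ s ⊗ s ⊗ u)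
    ⊕ k ⊗ k ⊗ (lit 2 ⊕ lit 4 ⊗ u ⊕ u ⊗ u ⊕ lit 4 ⊗ s ⊕ lit 8 ⊗ s ⊗ u ⊕ lit 2 ⊗ s ⊗ u ⊗ u)
    ⊕ k ⊗ k ⊗ k ⊗ (lit 4 ⊗ u ⊕ lit 2 ⊗ u ⊗ u)
    where k = var (# 0) ; s = var (# 1) ; u = var (# 2)

  normalDrop : NatPoly 4
  normalDrop = lit 2 ⊗ k ⊕ lit 2 ⊗ s ⊕ lit 2 ⊗ ρ
    where k = var (# 0) ; s = var (# 1) ; ρ = var (# 3)

  private
    Gₚ : ∀ {n} → Polynomial n → Polynomial n → Polynomial n
    Gₚ x t = x :* x :+ t :* t :+ con 1ℤ

    Dₚ : ∀ {n} → Polynomial n → Polynomial n → Polynomial n → Polynomial n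
    Dₚ x t b = t :* t :* (con 1ℤ :+ b :* b) :+ (x :- b) :* (x :- b)

    envₚ : ∀ {n} → Polynomial n → Polynomial n → Polynomial n → Polynomial n → Vec (Polynomial n) 4
    envₚ a k t ρ = k ∷ a :- (con 1ℤ :+ k) ∷ t :- con 1ℤ ∷ ρ ∷ []

  module Shift (a k t ρ : Carrier) where

    x c x′ a′ c′ G₀ G₁ D₀ₐ D₀꜀ D₁ₐ D₁꜀ : Carrier
    x = a + t * k
    c = a + ρ
    x′ = x - 1#
    a′ = a - 1#
    c′ = c - 1#
    G₀ = x * x + t * t + 1#
    G₁ = x′ * x′ + t * t + 1#
    D₀ₐ = pencilNormal² x t a
    D₀꜀ = pencilNormal² x t c
    D₁ₐ = pencilNormal² x′ t a′
    D₁꜀ = pencilNormal² x′ t c′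

    env : Vec Carrier 4
    env = k ∷ a - (1# + k) ∷ t - 1# ∷ ρ ∷ []

    ratio-gain : G₁ * D₀ₐ - G₀ * D₁ₐ ≡ t * t * (1# + eval ratioGain env)
    ratio-gain = solve 4 (λ a k t ρ → let x = a :+ t :* k ; x′ = x :- con 1ℤ in
        Gₚ x′ t :* Dₚ x t a :- Gₚ x t :* Dₚ x′ t (a :- con 1ℤ)
          := t :* t :* (con 1ℤ :+ toPolynomial ratioGain (envₚ a k t ρ)))
      ≡.refl a k t ρ

    normal-drop : D₀꜀ - D₁꜀ ≡ t * t * (1# + eval normalDrop env)
    normal-drop = solve 4 (λ a k t ρ → let x = a :+ t :* k ; c = a :+ ρ in
        Dₚ x t c :- Dₚ (x :- con 1ℤ) t (c :- con 1ℤ)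
          := t :* t :* (con 1ℤ :+ toPolynomial normalDrop (envₚ a k t ρ)))
      ≡.refl a k t ρ

    cross-difference :
      (t * (c′ - a′)) * (t * (c′ - a′)) * G₁ * (D₀ₐ * D₀꜀) - (t * (c - a)) * (t * (c - a)) * G₀ * (D₁ₐ * D₁꜀)
        ≡ (t * ρ) * (t * ρ) * ((G₁ * D₀ₐ - G₀ * D₁ₐ) * D₀꜀ + G₀ * D₁ₐ * (D₀꜀ - D₁꜀))
    cross-difference = begin
      (t * (c′ - a′)) * (t * (c′ - a′)) * G₁ * (D₀ₐ * D₀꜀) - (t * (c - a)) * (t * (c - a)) * G₀ * (D₁ₐ * D₁꜀)
        ≡⟨ ≡.cong₂ (λ p q → p * p * G₁ * (D₀ₐ * D₀꜀) - q * q * G₀ * (D₁ₐ * D₁꜀)) shifted-span span ⟩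
      T * G₁ * (D₀ₐ * D₀꜀) - T * G₀ * (D₁ₐ * D₁꜀)
        ≡⟨ solve 7 (λ T G₀ G₁ D₀ₐ D₀꜀ D₁ₐ D₁꜀ →
              T :* G₁ :* (D₀ₐ :* D₀꜀) :- T :* G₀ :* (D₁ₐ :* D₁꜀)
                := T :* ((G₁ :* D₀ₐ :- G₀ :* D₁ₐ) :* D₀꜀ :+ G₀ :* D₁ₐ :* (D₀꜀ :- D₁꜀)))
            ≡.refl T G₀ G₁ D₀ₐ D₀꜀ D₁ₐ D₁꜀ ⟩
      T * ((G₁ * D₀ₐ - G₀ * D₁ₐ) * D₀꜀ + G₀ * D₁ₐ * (D₀꜀ - D₁꜀))
        ∎
      where
        T = (t * ρ) * (t * ρ)
        span : t * (c - a) ≡ t * ρ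
        span = solve 3 (λ a t ρ → t :* (a :+ ρ :- a) := t :* ρ) ≡.refl a t ρ
        shifted-span : t * (c′ - a′) ≡ t * ρ
        shifted-span = solve 3 (λ a t ρ → t :* (a :+ ρ :- con 1ℤ :- (a :- con 1ℤ)) := t :* ρ) ≡.refl a t ρ

  sin²Pencil-shift : ∀ {a k t ρ} → 1# + k ≤ a → 1# < 1# + k → 1# ≤ t → 0# < ρ →
    sin²Pencil (a + t * k) t a (a + ρ) < sin²Pencil ((a + t * k) - 1#) t (a - 1#) ((a + ρ) - 1#)
  sin²Pencil-shift {a} {k} {t} {ρ} 1+k≤a 1<1+k 1≤t 0<ρ =
    *⁻¹-<-*⁻¹ (*-pos (D-pos x a) (D-pos x c)) (*-pos (D-pos x′ a′) (D-pos x′ c′))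
      (0<y-x⇒x<y (≡.subst (0# <_) (≡.sym cross-difference)
        (*-pos (*-pos 0<tρ 0<tρ)
               (pos+nonneg⇒pos (*-pos 0<gain (D-pos x c)) (inj₁ (*-pos (*-pos 0<G₀ (D-pos x′ a′)) 0<drop))))))
    where
      open Shift a k t ρ
      0<t = 1≤x⇒0<x 1≤t
      0<t² = *-pos 0<t 0<t
      0<tρ = *-pos 0<t 0<ρ
      D-pos = λ y b → pencilNormal²-pos {t} y b 0<t
      0<G₀ = nonneg+pos⇒pos (nonneg+nonneg⇒nonneg (0≤x*x x) (0≤x*x t)) 0<1
      0<k = ≡.subst (0# <_) (solve 1 (λ k → con 1ℤ :+ k :- con 1ℤ := k) ≡.refl k) (x<y⇒0<y-x 1<1+k)
      0≤env : All (0# ≤_) env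
      0≤env = inj₁ 0<k ∷ x≤y⇒0≤y-x 1+k≤a ∷ x≤y⇒0≤y-x 1≤t ∷ inj₁ 0<ρ ∷ []
      0<gain = ≡.subst (0# <_) (≡.sym ratio-gain) (*-pos 0<t² (pos+nonneg⇒pos 0<1 (eval-nonneg 0≤env ratioGain)))
      0<drop = ≡.subst (0# <_) (≡.sym normal-drop) (*-pos 0<t² (pos+nonneg⇒pos 0<1 (eval-nonneg 0≤env normalDrop)))

proposition5p1 : (R : RealField) → let open Geometry R in
    (a k t ρ : Carrier) →
    1# + k ≤ a → 1# < 1# + k → 1# ≤ t → 0# < ρ →
    sin²PlaneAngle (ξ a k t) (Q₁ a) (ξ a k t) (Q₂ a ρ)
    < sin²PlaneAngle (L (ξ a k t)) (L (Q₁ a)) (L (ξ a k t)) (L (Q₂ a ρ))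
proposition5p1 R a k t ρ 1+k≤a 1<1+k 1≤t 0<ρ =
  ≡.subst₂ _<_ (≡.sym (sin²PlaneAngle-pencil (a + t * k) a (a + ρ) 0<t))
               (≡.sym (sin²PlaneAngle-pencil ((a + t * k) - 1#) (a - 1#) ((a + ρ) - 1#) 0<t))
               (sin²Pencil-shift 1+k≤a 1<1+k 1≤t 0<ρ)
  where
    open Geometry R
    open OrderedFieldProperties R using (1≤x⇒0<x)
    open PlaneAngles R using (sin²PlaneAngle-pencil)
    open ShiftInequality R using (sin²Pencil-shift)
    0<t = 1≤x⇒0<x 1≤t
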